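{- Let $\pi:\tilde G\to G$ be a surjective homomorphism of finite groups, and $M$ a $G$-lattice (viewed as a $\tilde G$-module via $\pi$). Let $\mathcal{D}$ and $\tilde{\mathcal{D}}$ be sets of subgroups of $G$ and $\tilde G$ respectively. Assume that $\tilde{\mathcal{D}}$ contains all cyclic subgroups of $\tilde G$ and that $\tilde D\mapsto\pi(\tilde D)$ defines a surjection $\tilde{\mathcal{D}}\to\mathcal{D}$. Then the inflation map $H^2(G,M)\to H^2(\tilde G,M)$ induces an isomorphism $\mathrm{III}^2_{\mathcal{D}}(G,M)\cong\mathrm{III}^2_{\tilde{\mathcal{D}}}(\tilde G,M)$.
   Context: A $G$-lattice is a finitely generated $\mathbb{Z}$-torsion-free abelian group with a left $G$-action. For a set $\mathcal{D}$ of subgroups of $G$ and a $G$-module $M$, $\mathrm{III}^2_{\mathcal{D}}(G,M):=\ker\big(H^2(G,M)\to\bigoplus_{D\in\mathcal{D}}H^2(D,M)\big)$ (product of restriction maps). -}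

module Defs where

open import Data.Nat using (ℕ; suc)
open import Data.Fin using (Fin; toℕ)
open import Data.Fin.Properties using (any?) renaming (_≟_ to _≟F_)
open import Data.Bool using (Bool; true)
open import Data.Bool.Properties using () renaming (_≟_ to _≟B_)
open import Data.Integer using (ℤ) renaming (_+_ to _+ℤ_; _-_ to _-ℤ_)
open import Data.Vec using (Vec; lookup; tabulate; zipWith; replicate)
open import Data.Product using (Σ; ∃; _×_; _,_)
open import Relation.Nullary.Decidable using (⌊_⌋; _×-dec_)
open import Relation.Binary.PropositionalEquality using (_≡_)

-- A finite group, presented on the carrier Fin order (every finite group is
-- isomorphic to such a one).
record FinGroup : Set where
  field
    order : ℕ
    _∙_   : Fin order → Fin order → Fin order
    e     : Fin order
    inv   : Fin order → Fin order
    assoc : ∀ x y z → (x ∙ y) ∙ z ≡ x ∙ (y ∙ z)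
    idˡ   : ∀ x → e ∙ x ≡ x
    idʳ   : ∀ x → x ∙ e ≡ x
    invˡ  : ∀ x → inv x ∙ x ≡ e
    invʳ  : ∀ x → x ∙ inv x ≡ e

open FinGroup public

Carrier : FinGroup → Set
Carrier G = Fin (order G)

IsHom : (H G : FinGroup) → (Carrier H → Carrier G) → Set
IsHom H G π = ∀ x y → π (_∙_ H x y) ≡ _∙_ G (π x) (π y)

Surjective : (H G : FinGroup) → (Carrier H → Carrier G) → Set
Surjective H G π = ∀ y → ∃ λ x → π x ≡ y

Subset : FinGroup → Set
Subset G = Vec Bool (order G)

Mem : (G : FinGroup) → Carrier G → Subset G → Set
Mem G x S = lookup S x ≡ true

IsSubgroup : (G : FinGroup) → Subset G → Set
IsSubgroup G S = (Mem G (e G) S)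
               × (∀ x y → Mem G x S → Mem G y S → Mem G (_∙_ G x y) S)
               × (∀ x → Mem G x S → Mem G (inv G x) S)

pow : (G : FinGroup) → Carrier G → ℕ → Carrier G
pow G g 0       = e G
pow G g (suc k) = _∙_ G g (pow G g k)

-- cyclic subgroup generated by g: { g^k : 0 ≤ k ≤ |G| } (this is all powers)
cyclic : (G : FinGroup) → Carrier G → Subset G
cyclic G g = tabulate λ x →
  ⌊ any? {P = λ (k : Fin (suc (order G))) → pow G g (toℕ k) ≡ x}
         (λ k → pow G g (toℕ k) ≟F x) ⌋

image : (H G : FinGroup) → (Carrier H → Carrier G) → Subset H → Subset G
image H G π D = tabulate λ y →
  ⌊ any? {P = λ x → (lookup D x ≡ true) × (π x ≡ y)}
         (λ x → (lookup D x ≟B true) ×-dec (π x ≟F y)) ⌋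

-- G-lattice: ℤ^rank with a left G-action by additive (hence ℤ-linear) maps.
-- (A finitely generated ℤ-torsion-free abelian group is free of finite rank.)
Vecℤ : ℕ → Set
Vecℤ r = Vec ℤ r

_+ᵥ_ : ∀ {r} → Vecℤ r → Vecℤ r → Vecℤ r
_+ᵥ_ = zipWith _+ℤ_

_-ᵥ_ : ∀ {r} → Vecℤ r → Vecℤ r → Vecℤ r
_-ᵥ_ = zipWith _-ℤ_

record Lattice (G : FinGroup) : Set where
  field
    rank    : ℕ
    act     : Carrier G → Vecℤ rank → Vecℤ rank
    act-add : ∀ g u v → act g (u +ᵥ v) ≡ act g u +ᵥ act g v
    act-e   : ∀ u → act (e G) u ≡ u
    act-∙   : ∀ g h u → act (_∙_ G g h) u ≡ act g (act h u)

open Lattice public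

Cochain2 : (G : FinGroup) → ℕ → Set
Cochain2 G r = Carrier G → Carrier G → Vecℤ r

IsCocycle : (G : FinGroup) {r : ℕ} → (Carrier G → Vecℤ r → Vecℤ r) → Cochain2 G r → Set
IsCocycle G act f = ∀ g h k →
  act g (f h k) +ᵥ f g (_∙_ G h k) ≡ f (_∙_ G g h) k +ᵥ f g h

-- f restricted to S × S equals δc for some 1-cochain c, where
-- δc(g,h) = g·c(h) − c(gh) + c(g).  For S a subgroup D this says that
-- res_D [f] = 0 in H²(D, M).
IsCoboundaryOn : (G : FinGroup) {r : ℕ} → (Carrier G → Vecℤ r → Vecℤ r)
               → Subset G → Cochain2 G r → Set
IsCoboundaryOn G {r} act S f = Σ (Carrier G → Vecℤ r) λ c → ∀ g h → Mem G g S → Mem G h S →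
  f g h +ᵥ c (_∙_ G g h) ≡ act g (c h) +ᵥ c g

full : (G : FinGroup) → Subset G
full G = replicate _ true

Cohomologous : (G : FinGroup) {r : ℕ} → (Carrier G → Vecℤ r → Vecℤ r)
             → Cochain2 G r → Cochain2 G r → Set
Cohomologous G act f f' = IsCoboundaryOn G act (full G) (λ g h → f g h -ᵥ f' g h)

InIII : (G : FinGroup) {r : ℕ} → (Carrier G → Vecℤ r → Vecℤ r)
      → (Subset G → Set) → Cochain2 G r → Set
InIII G act 𝒟 f = IsCocycle G act f × (∀ D → 𝒟 D → IsCoboundaryOn G act D f)

inflate : (H G : FinGroup) {r : ℕ} → (Carrier H → Carrier G) → Cochain2 G r → Cochain2 H r
inflate H G π f x y = f (π x) (π y)

{-# OPTIONS --safe #-}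
module Submission where

-- Let N = ker π.  Inflation lands in III², and a class is in the image of inflation
-- exactly when it is represented by a cocycle vanishing as soon as one argument lies
-- in N.  Two facts about the finite group N acting trivially on the torsion-free M
-- drive the argument: every homomorphism N → M is zero, and a 2-cocycle on N whose
-- restriction to each cyclic subgroup splits is itself split, since averaging over H
-- exhibits |H| times it as a coboundary.  The first makes trivialisations of inflated
-- cocycles constant on the fibres of π, which gives injectivity and lets splittings on
-- D̃ descend to π(D̃); the second, with the cyclic subgroups in 𝒟̃, puts every class of
-- III²_𝒟̃ in the image of inflation.

open import Defs
open import Level using (0ℓ)
open import Algebra.Bundles using (Group; CommutativeRing)
open import Algebra.Structures using (IsCommutativeRing)
open import Algebra.Solver.Ring.AlmostCommutativeRing
  using (fromCommutativeRing; _-Raw-AlmostCommutative⟶_)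
import Algebra.Properties.Group as GroupProperties
import Algebra.Properties.CommutativeMonoid.Sum as CommutativeMonoidSum
open import Data.Bool using (true)
import Data.Bool.Properties as Bool
open import Data.Empty using (⊥-elim)
open import Data.Fin using (Fin; toℕ; fromℕ<)
open import Data.Fin.Permutation using (Permutation; permutation)
import Data.Fin.Properties as Fin
open import Data.Integer as ℤ using (ℤ; 0ℤ; 1ℤ)
import Data.Integer.Properties as ℤ
open import Data.Maybe using (Maybe; just; nothing)
open import Data.Nat as ℕ using (ℕ; zero; suc)
import Data.Nat.Properties as ℕ
open import Data.Product using (Σ; ∃; _×_; _,_; proj₁; proj₂)
open import Data.Vec using (Vec; []; _∷_; lookup; replicate; zipWith; map)
open import Data.Vec.Properties
  using ( ∷-injective; lookup∘tabulate; lookup-replicate; map-replicate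
        ; zipWith-assoc; zipWith-comm; zipWith-identityˡ; zipWith-identityʳ
        ; zipWith-inverseˡ; zipWith-inverseʳ; zipWith-distribˡ; zipWith-distribʳ
        ; zipWith-zeroˡ; zipWith-replicate; zipWith-map₂)
open import Function using (_∘_)
open import Function.Bundles using (Equivalence)
open import Relation.Nullary using (Dec; yes; no)
open import Relation.Nullary.Decidable using (_×-dec_; toWitness; fromWitness)
open import Relation.Binary.PropositionalEquality

module FinGroupProperties (K : FinGroup) where

  group : Group 0ℓ 0ℓ
  group = record
    { Carrier = Carrier K
    ; _≈_ = _≡_
    ; _∙_ = _∙_ K
    ; ε = e K
    ; _⁻¹ = inv K
    ; isGroup = record
      { isMonoid = record
        { isSemigroup = record
          { isMagma = record { isEquivalence = isEquivalence ; ∙-cong = cong₂ (_∙_ K) }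
          ; assoc = assoc K }
        ; identity = idˡ K , idʳ K }
      ; inverse = invˡ K , invʳ K
      ; ⁻¹-cong = cong (inv K) } }

  open GroupProperties group public
    using (identityˡ-unique; \\-leftDividesˡ; \\-leftDividesʳ)

  ∈-full : ∀ x → Mem K x (full K)
  ∈-full x = lookup-replicate x true

  full-subgroup : IsSubgroup K (full K)
  full-subgroup = ∈-full (e K) , (λ x y _ _ → ∈-full (_∙_ K x y)) , λ x _ → ∈-full (inv K x)

  pow∈cyclic : ∀ g k → k ℕ.≤ order K → Mem K (pow K g k) (cyclic K g)
  pow∈cyclic g k k≤|K| = trans (lookup∘tabulate _ (pow K g k)) (Equivalence.to Bool.T-≡
    (fromWitness (fromℕ< (ℕ.s≤s k≤|K|) , cong (pow K g) (Fin.toℕ-fromℕ< (ℕ.s≤s k≤|K|)))))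

  ∈cyclic : ∀ g → Mem K g (cyclic K g)
  ∈cyclic g = subst (λ x → Mem K x (cyclic K g)) (idʳ K g)
    (pow∈cyclic g 1 (ℕ.≤-trans (ℕ.s≤s ℕ.z≤n) (Fin.toℕ<n (e K))))

  pow-repeats : ∀ g → ∃ λ i → ∃ λ j → i ℕ.< j × j ℕ.≤ order K × pow K g i ≡ pow K g j
  pow-repeats g with Fin.pigeonhole (ℕ.n<1+n (order K)) (λ (k : Fin (suc (order K))) → pow K g (toℕ k))
  ... | i , j , i<j , gⁱ≡gʲ = toℕ i , toℕ j , i<j , Fin.toℕ≤pred[n] j , gⁱ≡gʲ

  pow∈ : (S : Subset K) → IsSubgroup K S → ∀ {g} → Mem K g S → ∀ k → Mem K (pow K g k) S
  pow∈ S (e∈S , _ , _) g∈S zero = e∈S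
  pow∈ S S-subgroup@(_ , ∙-closed , _) g∈S (suc k) = ∙-closed _ _ g∈S (pow∈ S S-subgroup g∈S k)

torsion-free : ∀ {n i} → i ≢ 0ℤ → (v : Vec ℤ n)
  → zipWith ℤ._*_ (replicate n i) v ≡ replicate n 0ℤ → v ≡ replicate n 0ℤ
torsion-free i≢0 [] _ = refl
torsion-free {i = i} i≢0 (x ∷ v) eq with ∷-injective eq
... | ix≡0 , iv≡0 = cong₂ _∷_ x≡0 (torsion-free i≢0 v iv≡0)
  where
  x≡0 : x ≡ 0ℤ
  x≡0 = ℤ.*-cancelˡ-≡ i x 0ℤ {{ℤ.≢-nonZero i≢0}} (trans ix≡0 (sym (ℤ.*-zeroʳ i)))

-- The pointwise product on ℤ^r means nothing here: it only makes ℤ^r a commutative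
-- ring, so that the ring solver (with coefficients in ℤ) checks ℤ-linear identities
-- between vectors.
module Pointwise (r : ℕ) where

  isCommutativeRing : IsCommutativeRing {A = Vecℤ r} _≡_
    _+ᵥ_ (zipWith ℤ._*_) (map (ℤ.-_)) (replicate r 0ℤ) (replicate r 1ℤ)
  isCommutativeRing = record
    { isRing = record
      { +-isAbelianGroup = record
        { isGroup = record
          { isMonoid = record
            { isSemigroup = record
              { isMagma = record { isEquivalence = isEquivalence ; ∙-cong = cong₂ _+ᵥ_ }
              ; assoc = zipWith-assoc ℤ.+-assoc }
            ; identity = zipWith-identityˡ ℤ.+-identityˡ , zipWith-identityʳ ℤ.+-identityʳ }
          ; inverse = zipWith-inverseˡ ℤ.+-inverseˡ , zipWith-inverseʳ ℤ.+-inverseʳ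
          ; ⁻¹-cong = cong (map (ℤ.-_)) }
        ; comm = zipWith-comm ℤ.+-comm }
      ; *-cong = cong₂ _
      ; *-assoc = zipWith-assoc ℤ.*-assoc
      ; *-identity = zipWith-identityˡ ℤ.*-identityˡ , zipWith-identityʳ ℤ.*-identityʳ
      ; distrib = zipWith-distribˡ ℤ.*-distribˡ-+ , zipWith-distribʳ ℤ.*-distribʳ-+ }
    ; *-comm = zipWith-comm ℤ.*-comm }

  commutativeRing : CommutativeRing 0ℓ 0ℓ
  commutativeRing = record { isCommutativeRing = isCommutativeRing }

  open CommutativeRing commutativeRing public
    using ( _+_; _*_; -_; _-_; 0#; +-comm; +-identityˡ; +-identityʳ; -‿inverseˡ; -‿inverseʳ; zeroʳ
          ; +-commutativeMonoid)
  open CommutativeMonoidSum +-commutativeMonoid public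
    using (sum; sum-cong-≗; ∑-distrib-+; ∑-permute; sum-replicate)
  open import Algebra.Definitions.RawMonoid (CommutativeRing.+-rawMonoid commutativeRing) public
    using () renaming (_×_ to _×ᵥ_)
  open GroupProperties (CommutativeRing.+-group commutativeRing) public
    using (inverseˡ-unique) renaming (∙-cancelˡ to +-cancelˡ; ∙-cancelʳ to +-cancelʳ)

  scalar : ℤ → Vecℤ r
  scalar = replicate r

  scalar-morphism : ℤ.+-*-rawRing -Raw-AlmostCommutative⟶ fromCommutativeRing commutativeRing
  scalar-morphism = record
    { ⟦_⟧ = scalar
    ; +-homo = λ i j → sym (zipWith-replicate ℤ._+_ i j)
    ; *-homo = λ i j → sym (zipWith-replicate ℤ._*_ i j)
    ; -‿homo = λ i → sym (map-replicate (ℤ.-_) i r)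
    ; 0-homo = refl
    ; 1-homo = refl }

  scalar-equal? : (i j : ℤ) → Maybe (scalar i ≡ scalar j)
  scalar-equal? i j with i ℤ.≟ j
  ... | yes i≡j = just (cong scalar i≡j)
  ... | no _ = nothing

  open import Algebra.Solver.Ring ℤ.+-*-rawRing (fromCommutativeRing commutativeRing)
    scalar-morphism scalar-equal? public
    using (solve; _:=_; _:+_; _:-_; _:*_; :-_; con)

  -ᵥ≡- : ∀ u v → u -ᵥ v ≡ u - v
  -ᵥ≡- u v = sym (zipWith-map₂ ℤ._+_ (ℤ.-_) u v)

  x≡y⇒x-y≡0 : ∀ {x y} → x ≡ y → x - y ≡ 0#
  x≡y⇒x-y≡0 {x} refl = -‿inverseʳ x

  -- Linear consequences: the solver writes x - y as a combination e of differences
  -- of known equations, and e ≡ 0# is assembled from those equations.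
  by-difference : ∀ {x y e} → e ≡ 0# → x - y ≡ e → x ≡ y
  by-difference {x} {y} refl x-y≡e = begin
    x             ≡⟨ solve 2 (λ x y → x := (x :- y) :+ y) refl x y ⟩
    (x - y) + y   ≡⟨ cong (_+ y) x-y≡e ⟩
    0# + y        ≡⟨ +-identityˡ y ⟩
    y             ∎
    where open ≡-Reasoning

  infixl 6 _⊕_
  infix 8 ⊖_

  _⊕_ : ∀ {a b} → a ≡ 0# → b ≡ 0# → a + b ≡ 0#
  refl ⊕ refl = +-identityˡ 0#

  ⊖_ : ∀ {a} → a ≡ 0# → - a ≡ 0#
  ⊖ refl = solve 0 (:- con 0ℤ := con 0ℤ) refl

  _⊛_ : ∀ c {a} → a ≡ 0# → c * a ≡ 0#
  c ⊛ refl = zeroʳ c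

  x-y≡0⇒x≡y : ∀ {x y} → x - y ≡ 0# → x ≡ y
  x-y≡0⇒x≡y x-y≡0 = by-difference x-y≡0 refl

  -+-interchange : ∀ a a′ b b′ → a - a′ + (b - b′) ≡ (a + b) - (a′ + b′)
  -+-interchange = solve 4 (λ a a′ b b′ → a :- a′ :+ (b :- b′) := (a :+ b) :- (a′ :+ b′)) refl

  scalar-torsion-free : ∀ {i} → i ≢ 0ℤ → ∀ v → scalar i * v ≡ 0# → v ≡ 0#
  scalar-torsion-free i≢0 = torsion-free i≢0

  scalar-suc* : ∀ k v → scalar (ℤ.+ suc k) * v ≡ v + scalar (ℤ.+ k) * v
  scalar-suc* k v = trans (cong (_* v) (sym (zipWith-replicate ℤ._+_ 1ℤ (ℤ.+ k))))
    (solve 2 (λ s v → (con 1ℤ :+ s) :* v := v :+ s :* v) refl (scalar (ℤ.+ k)) v)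

  ×ᵥ≡scalar* : ∀ n v → n ×ᵥ v ≡ scalar (ℤ.+ n) * v
  ×ᵥ≡scalar* zero v = sym (zipWith-zeroˡ ℤ.*-zeroˡ v)
  ×ᵥ≡scalar* (suc n) v = trans (cong (v +_) (×ᵥ≡scalar* n v)) (sym (scalar-suc* n v))

  scalar-sub* : ∀ i j v → scalar (i ℤ.- j) * v ≡ scalar i * v - scalar j * v
  scalar-sub* i j v = begin
    scalar (i ℤ.- j) * v               ≡⟨ cong (_* v) (sym (zipWith-replicate ℤ._+_ i (ℤ.- j))) ⟩
    (scalar i + scalar (ℤ.- j)) * v    ≡⟨ cong (λ t → (scalar i + t) * v) (map-replicate (ℤ.-_) j r) ⟨
    (scalar i - scalar j) * v
      ≡⟨ solve 3 (λ s t v → (s :- t) :* v := s :* v :- t :* v) refl (scalar i) (scalar j) v ⟩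
    scalar i * v - scalar j * v        ∎
    where open ≡-Reasoning


module _ (K : FinGroup) {r : ℕ} where
  open Pointwise r
  open FinGroupProperties K using (pow-repeats)

  pow-additive⇒≡0 : (Ψ : Carrier K → Vecℤ r) (n : Carrier K) → Ψ (e K) ≡ 0#
    → (∀ k → k ℕ.< order K → Ψ (_∙_ K n (pow K n k)) ≡ Ψ n + Ψ (pow K n k))
    → Ψ n ≡ 0#
  pow-additive⇒≡0 Ψ n Ψe≡0 additive = repetition⇒≡0 (pow-repeats n)
    where
    open ≡-Reasoning
    Ψ-pow : ∀ k → k ℕ.≤ order K → Ψ (pow K n k) ≡ scalar (ℤ.+ k) * Ψ n
    Ψ-pow zero _ = trans Ψe≡0 (sym (zipWith-zeroˡ ℤ.*-zeroˡ (Ψ n)))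
    Ψ-pow (suc k) k<|K| = begin
      Ψ (_∙_ K n (pow K n k))       ≡⟨ additive k k<|K| ⟩
      Ψ n + Ψ (pow K n k)           ≡⟨ cong (Ψ n +_) (Ψ-pow k (ℕ.<⇒≤ k<|K|)) ⟩
      Ψ n + scalar (ℤ.+ k) * Ψ n    ≡⟨ scalar-suc* k (Ψ n) ⟨
      scalar (ℤ.+ suc k) * Ψ n      ∎

    repetition⇒≡0 : (∃ λ i → ∃ λ j → i ℕ.< j × j ℕ.≤ order K × pow K n i ≡ pow K n j) → Ψ n ≡ 0#
    repetition⇒≡0 (i , j , i<j , j≤|K| , nⁱ≡nʲ) = scalar-torsion-free j-i≢0 (Ψ n) (begin
      scalar (ℤ.+ j ℤ.- ℤ.+ i) * Ψ n             ≡⟨ scalar-sub* (ℤ.+ j) (ℤ.+ i) (Ψ n) ⟩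
      scalar (ℤ.+ j) * Ψ n - scalar (ℤ.+ i) * Ψ n
        ≡⟨ cong₂ _-_ (Ψ-pow j j≤|K|) (Ψ-pow i (ℕ.<⇒≤ (ℕ.<-≤-trans i<j j≤|K|))) ⟨
      Ψ (pow K n j) - Ψ (pow K n i)               ≡⟨ x≡y⇒x-y≡0 (cong Ψ (sym nⁱ≡nʲ)) ⟩
      0#                                          ∎)
      where
      j-i≢0 : ℤ.+ j ℤ.- ℤ.+ i ≢ 0ℤ
      j-i≢0 j-i≡0 = ℕ.<-irrefl (ℤ.+-injective (sym (ℤ.i-j≡0⇒i≡j _ _ j-i≡0))) i<j

module LatticeProperties {K : FinGroup} (M : Lattice K) where
  open Pointwise (rank M)

  open ≡-Reasoning

  act-0# : ∀ g → act M g 0# ≡ 0#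
  act-0# g = +-cancelˡ (act M g 0#) _ _ (begin
    act M g 0# + act M g 0#   ≡⟨ act-add M g 0# 0# ⟨
    act M g (0# + 0#)         ≡⟨ cong (act M g) (+-identityˡ 0#) ⟩
    act M g 0#                ≡⟨ +-identityʳ _ ⟨
    act M g 0# + 0#           ∎)

  act-neg : ∀ g u → act M g (- u) ≡ - act M g u
  act-neg g u = inverseˡ-unique _ _ (begin
    act M g (- u) + act M g u   ≡⟨ act-add M g (- u) u ⟨
    act M g (- u + u)           ≡⟨ cong (act M g) (-‿inverseˡ u) ⟩
    act M g 0#                  ≡⟨ act-0# g ⟩
    0#                          ∎)

  act-sub : ∀ g u v → act M g (u - v) ≡ act M g u - act M g v
  act-sub g u v = trans (act-add M g u (- v)) (cong (act M g u +_) (act-neg g v))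

module Cochains {K : FinGroup} (M : Lattice K) where
  open Pointwise (rank M)
  open LatticeProperties M
  open ≡-Reasoning

  private
    V = Vecℤ (rank M)
    C² = Cochain2 K (rank M)
    _·_ = _∙_ K
    ρ = act M

  Trivialises : Subset K → C² → (Carrier K → V) → Set
  Trivialises S f a = ∀ g h → Mem K g S → Mem K h S → f g h + a (g · h) ≡ ρ g (a h) + a g

  trivialises-resp : ∀ S {f f′ a} → (∀ g h → f g h ≡ f′ g h) → Trivialises S f a → Trivialises S f′ a
  trivialises-resp S {a = a} f≗f′ f-triv g h g∈S h∈S =
    trans (cong (_+ a (g · h)) (sym (f≗f′ g h))) (f-triv g h g∈S h∈S)

  δ : (Carrier K → V) → C²
  δ w g h = ρ g (w h) - w (g · h) + w g

  _-δ_ : C² → (Carrier K → V) → C²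
  (f -δ w) g h = f g h - δ w g h

  δ-cocycle : ∀ w → IsCocycle K ρ (δ w)
  δ-cocycle w g h k = begin
    ρ g (δ w h k) + δ w g (h · k)
      ≡⟨ cong₂ _+_ ρ-δ (cong (λ x → ρ g (w (h · k)) - w x + w g) (sym (assoc K g h k))) ⟩
    (ρ (g · h) (w k) - ρ g (w (h · k)) + ρ g (w h)) + (ρ g (w (h · k)) - w ((g · h) · k) + w g)
      ≡⟨ solve 6 (λ a b c d e f → (a :- b :+ c) :+ (b :- d :+ e) := (a :- d :+ f) :+ (c :- f :+ e)) refl
           (ρ (g · h) (w k)) (ρ g (w (h · k))) (ρ g (w h)) (w ((g · h) · k)) (w g) (w (g · h)) ⟩
    δ w (g · h) k + δ w g h ∎
    where
    ρ-δ : ρ g (δ w h k) ≡ ρ (g · h) (w k) - ρ g (w (h · k)) + ρ g (w h)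
    ρ-δ = begin
      ρ g (ρ h (w k) - w (h · k) + w h)             ≡⟨ act-add M g _ _ ⟩
      ρ g (ρ h (w k) - w (h · k)) + ρ g (w h)       ≡⟨ cong (_+ ρ g (w h)) (act-sub g _ _) ⟩
      ρ g (ρ h (w k)) - ρ g (w (h · k)) + ρ g (w h)
        ≡⟨ cong (λ x → x - ρ g (w (h · k)) + ρ g (w h)) (act-∙ M g h (w k)) ⟨
      ρ (g · h) (w k) - ρ g (w (h · k)) + ρ g (w h) ∎

  cocycle-difference : ∀ {f f′} → IsCocycle K ρ f → IsCocycle K ρ f′ → IsCocycle K ρ (λ g h → f g h - f′ g h)
  cocycle-difference {f} {f′} f-cocycle f′-cocycle g h k = begin
    ρ g (f h k - f′ h k) + (f g (h · k) - f′ g (h · k))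
      ≡⟨ cong (_+ (f g (h · k) - f′ g (h · k))) (act-sub g _ _) ⟩
    ρ g (f h k) - ρ g (f′ h k) + (f g (h · k) - f′ g (h · k))
      ≡⟨ -+-interchange (ρ g (f h k)) (ρ g (f′ h k)) (f g (h · k)) (f′ g (h · k)) ⟩
    (ρ g (f h k) + f g (h · k)) - (ρ g (f′ h k) + f′ g (h · k))
      ≡⟨ cong₂ _-_ (f-cocycle g h k) (f′-cocycle g h k) ⟩
    (f (g · h) k + f g h) - (f′ (g · h) k + f′ g h)
      ≡⟨ -+-interchange (f (g · h) k) (f′ (g · h) k) (f g h) (f′ g h) ⟨
    (f (g · h) k - f′ (g · h) k) + (f g h - f′ g h) ∎

  -δ-cocycle : ∀ {f} → IsCocycle K ρ f → ∀ w → IsCocycle K ρ (f -δ w)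
  -δ-cocycle f-cocycle w = cocycle-difference f-cocycle (δ-cocycle w)

  -δ-trivialises : ∀ S {f a} w → Trivialises S f a → Trivialises S (f -δ w) (λ x → a x - w x)
  -δ-trivialises S {f} {a} w f-triv g h g∈S h∈S = begin
    (f g h - δ w g h) + (a (g · h) - w (g · h))
      ≡⟨ solve 5 (λ F A ρw wgh wg → (F :- (ρw :- wgh :+ wg)) :+ (A :- wgh) := (F :+ A) :- (ρw :+ wg)) refl
           (f g h) (a (g · h)) (ρ g (w h)) (w (g · h)) (w g) ⟩
    (f g h + a (g · h)) - (ρ g (w h) + w g)
      ≡⟨ cong (_- (ρ g (w h) + w g)) (f-triv g h g∈S h∈S) ⟩
    (ρ g (a h) + a g) - (ρ g (w h) + w g)
      ≡⟨ -+-interchange (ρ g (a h)) (ρ g (w h)) (a g) (w g) ⟨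
    ρ g (a h) - ρ g (w h) + (a g - w g)
      ≡⟨ cong (_+ (a g - w g)) (act-sub g (a h) (w h)) ⟨
    ρ g (a h - w h) + (a g - w g) ∎

  -δ-cohomologous : ∀ f w → Cohomologous K ρ (f -δ w) f
  -δ-cohomologous f w = (λ x → - w x) , λ g h _ _ → begin
    ((f -δ w) g h -ᵥ f g h) + - w (g · h)
      ≡⟨ cong (_+ - w (g · h)) (-ᵥ≡- ((f -δ w) g h) (f g h)) ⟩
    ((f g h - δ w g h) - f g h) + - w (g · h)
      ≡⟨ solve 4 (λ F ρw wgh wg → ((F :- (ρw :- wgh :+ wg)) :- F) :+ :- wgh := :- ρw :+ :- wg) refl
           (f g h) (ρ g (w h)) (w (g · h)) (w g) ⟩
    - ρ g (w h) + - w g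
      ≡⟨ cong (_+ - w g) (act-neg g (w h)) ⟨
    ρ g (- w h) + - w g ∎

  -δ-twice : ∀ f v w g h → ((f -δ v) -δ w) g h ≡ (f -δ (λ x → v x + w x)) g h
  -δ-twice f v w g h = begin
    (f g h - δ v g h) - δ w g h
      ≡⟨ solve 7 (λ F ρv ρw vgh wgh vg wg →
           (F :- (ρv :- vgh :+ vg)) :- (ρw :- wgh :+ wg)
             := F :- (ρv :+ ρw :- (vgh :+ wgh) :+ (vg :+ wg))) refl
           (f g h) (ρ g (v h)) (ρ g (w h)) (v (g · h)) (w (g · h)) (v g) (w g) ⟩
    f g h - (ρ g (v h) + ρ g (w h) - (v (g · h) + w (g · h)) + (v g + w g))
      ≡⟨ cong (λ x → f g h - (x - (v (g · h) + w (g · h)) + (v g + w g))) (act-add M g (v h) (w h)) ⟨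
    (f -δ (λ x → v x + w x)) g h ∎

  cocycle-eʳ : ∀ {f} → IsCocycle K ρ f → ∀ g → f g (e K) ≡ ρ g (f (e K) (e K))
  cocycle-eʳ {f} f-cocycle g = sym (+-cancelʳ (f g (e K)) _ _ (begin
    ρ g (f (e K) (e K)) + f g (e K)        ≡⟨ cong (λ x → ρ g (f (e K) (e K)) + f g x) (idˡ K (e K)) ⟨
    ρ g (f (e K) (e K)) + f g (e K · e K)  ≡⟨ f-cocycle g (e K) (e K) ⟩
    f (g · e K) (e K) + f g (e K)          ≡⟨ cong (λ x → f x (e K) + f g (e K)) (idʳ K g) ⟩
    f g (e K) + f g (e K)                  ∎))

  cocycle-eˡ : ∀ {f} → IsCocycle K ρ f → ∀ h → f (e K) h ≡ f (e K) (e K)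
  cocycle-eˡ {f} f-cocycle h = +-cancelˡ (f (e K) h) _ _ (begin
    f (e K) h + f (e K) h                   ≡⟨ cong₂ (λ x y → x + f (e K) y) (act-e M (f (e K) h)) (idˡ K h) ⟨
    ρ (e K) (f (e K) h) + f (e K) (e K · h) ≡⟨ f-cocycle (e K) (e K) h ⟩
    f (e K · e K) h + f (e K) (e K)         ≡⟨ cong (λ x → f x h + f (e K) (e K)) (idˡ K (e K)) ⟩
    f (e K) h + f (e K) (e K)               ∎)

module Inflation (H G : FinGroup) (π : Carrier H → Carrier G) (π-hom : IsHom H G π) (M : Lattice G) where
  open Pointwise (rank M)
  open FinGroupProperties using (∈-full; full-subgroup)
  open FinGroupProperties H using (\\-leftDividesˡ; \\-leftDividesʳ; pow∈; pow∈cyclic; ∈cyclic)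
  open ≡-Reasoning

  private
    R = rank M
    V = Vecℤ R
    _·_ = _∙_ H
    ε = e H

  π-e : π ε ≡ e G
  π-e = FinGroupProperties.identityˡ-unique G (π ε) (π ε) (trans (sym (π-hom ε ε)) (cong π (idˡ H ε)))

  M̃ : Lattice H
  M̃ = record
    { rank = R
    ; act = λ x → act M (π x)
    ; act-add = λ x → act-add M (π x)
    ; act-e = λ u → trans (cong (λ g → act M g u) π-e) (act-e M u)
    ; act-∙ = λ x y u → trans (cong (λ g → act M g u) (π-hom x y)) (act-∙ M (π x) (π y) u) }

  private
    ρ = act M̃
    module CG = Cochains M
    module CH = Cochains M̃
  open LatticeProperties M̃ using (act-0#)

  Kernel : Carrier H → Set
  Kernel x = π x ≡ e G

  ρ-kernel : ∀ {n} → Kernel n → ∀ u → ρ n u ≡ u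
  ρ-kernel n∈N u = trans (cong (λ g → act M g u) n∈N) (act-e M u)

  kernel-∙ : ∀ {n m} → Kernel n → Kernel m → Kernel (n · m)
  kernel-∙ {n} {m} n∈N m∈N = trans (π-hom n m) (trans (cong₂ (_∙_ G) n∈N m∈N) (idˡ G (e G)))

  kernel-pow : ∀ {n} → Kernel n → ∀ k → Kernel (pow H n k)
  kernel-pow n∈N zero = π-e
  kernel-pow n∈N (suc k) = kernel-∙ n∈N (kernel-pow n∈N k)

  fibre⇒kernel : ∀ {x y} → π x ≡ π y → Kernel (inv H x · y)
  fibre⇒kernel {x} {y} πx≡πy = begin
    π (inv H x · y)          ≡⟨ π-hom (inv H x) y ⟩
    _∙_ G (π (inv H x)) (π y) ≡⟨ cong (_∙_ G (π (inv H x))) πx≡πy ⟨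
    _∙_ G (π (inv H x)) (π x) ≡⟨ π-hom (inv H x) x ⟨
    π (inv H x · x)          ≡⟨ cong π (invˡ H x) ⟩
    π ε                      ≡⟨ π-e ⟩
    e G                      ∎

  π-∙-kernelʳ : ∀ x {n} → Kernel n → π (x · n) ≡ π x
  π-∙-kernelʳ x {n} n∈N = trans (π-hom x n) (trans (cong (_∙_ G (π x)) n∈N) (idʳ G (π x)))

  π-∙-kernelˡ : ∀ x {n} → Kernel n → π (n · x) ≡ π x
  π-∙-kernelˡ x {n} n∈N = trans (π-hom n x) (trans (cong (λ g → _∙_ G g (π x)) n∈N) (idˡ G (π x)))

  Inflated : Cochain2 H R → Set
  Inflated F = ∀ {x y x′ y′} → π x ≡ π x′ → π y ≡ π y′ → F x y ≡ F x′ y′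

  preimage? : (S : Subset H) (g : Carrier G) → Dec (∃ λ x → Mem H x S × π x ≡ g)
  preimage? S g = Fin.any? (λ x → (lookup S x Bool.≟ true) ×-dec (π x Fin.≟ g))

  image-∋ : ∀ S {x} → Mem H x S → Mem G (π x) (image H G π S)
  image-∋ S {x} x∈S = trans (lookup∘tabulate _ (π x))
    (Equivalence.to Bool.T-≡ (fromWitness {a? = preimage? S (π x)} (x , x∈S , refl)))

  image⇒preimage : ∀ S {g} → Mem G g (image H G π S) → ∃ λ x → Mem H x S × π x ≡ g
  image⇒preimage S {g} g∈πS = toWitness {a? = preimage? S g}
    (Equivalence.from Bool.T-≡ (trans (sym (lookup∘tabulate _ g)) g∈πS))

  -- On S ∩ ker π the trivialisation is, up to the constant a ε, a homomorphism to
  -- the torsion-free group ℤ^r, hence constant.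
  fibre-constant : (f : Cochain2 G R) (S : Subset H) → IsSubgroup H S → (a : Carrier H → V)
    → CH.Trivialises S (inflate H G π f) a
    → ∀ {x y} → Mem H x S → Mem H y S → π x ≡ π y → a x ≡ a y
  fibre-constant f S S-subgroup@(ε∈S , ∙-closed , inv-closed) a a-triv {x} {y} x∈S y∈S πx≡πy = begin
    a x                        ≡⟨ a-∙-kernel x∈S (∙-closed _ _ (inv-closed x x∈S) y∈S) (fibre⇒kernel πx≡πy) ⟨
    a (x · (inv H x · y))      ≡⟨ cong a (\\-leftDividesˡ x y) ⟩
    a y                        ∎
    where
    F₀ = f (π ε) (π ε)

    trivialises-ε : F₀ + a ε ≡ a ε + a ε
    trivialises-ε = begin
      F₀ + a ε          ≡⟨ cong (λ z → F₀ + a z) (idˡ H ε) ⟨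
      F₀ + a (ε · ε)    ≡⟨ a-triv ε ε ε∈S ε∈S ⟩
      ρ ε (a ε) + a ε   ≡⟨ cong (_+ a ε) (ρ-kernel π-e (a ε)) ⟩
      a ε + a ε         ∎

    trivialises-kernel : ∀ {n m} → Mem H n S → Mem H m S → Kernel n → Kernel m
      → F₀ + a (n · m) ≡ a m + a n
    trivialises-kernel {n} {m} n∈S m∈S n∈N m∈N = begin
      F₀ + a (n · m)              ≡⟨ cong (_+ a (n · m)) (cong₂ f (trans n∈N (sym π-e)) (trans m∈N (sym π-e))) ⟨
      f (π n) (π m) + a (n · m)   ≡⟨ a-triv n m n∈S m∈S ⟩
      ρ n (a m) + a n             ≡⟨ cong (_+ a n) (ρ-kernel n∈N (a m)) ⟩
      a m + a n                   ∎

    additive : ∀ {n m} → Mem H n S → Mem H m S → Kernel n → Kernel m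
      → a (n · m) - a ε ≡ (a n - a ε) + (a m - a ε)
    additive {n} {m} n∈S m∈S n∈N m∈N = by-difference
      (x≡y⇒x-y≡0 (trivialises-kernel n∈S m∈S n∈N m∈N) ⊕ ⊖ x≡y⇒x-y≡0 trivialises-ε)
      (solve 5 (λ F anm an am aε →
         (anm :- aε) :- ((an :- aε) :+ (am :- aε))
           := ((F :+ anm) :- (am :+ an)) :- ((F :+ aε) :- (aε :+ aε))) refl
         F₀ (a (n · m)) (a n) (a m) (a ε))

    kernel-trivial : ∀ {n} → Mem H n S → Kernel n → a n ≡ a ε
    kernel-trivial {n} n∈S n∈N = x-y≡0⇒x≡y (pow-additive⇒≡0 H (λ z → a z - a ε) n (-‿inverseʳ (a ε))
      λ k _ → additive n∈S (pow∈ S S-subgroup n∈S k) n∈N (kernel-pow n∈N k))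

    a-∙-kernel : ∀ {x n} → Mem H x S → Mem H n S → Kernel n → a (x · n) ≡ a x
    a-∙-kernel {x} {n} x∈S n∈S n∈N = +-cancelˡ (f (π x) (π ε)) (a (x · n)) (a x) (begin
      f (π x) (π ε) + a (x · n)  ≡⟨ cong (λ g → f (π x) g + a (x · n)) (trans n∈N (sym π-e)) ⟨
      f (π x) (π n) + a (x · n)  ≡⟨ a-triv x n x∈S n∈S ⟩
      ρ x (a n) + a x            ≡⟨ cong (λ z → ρ x z + a x) (kernel-trivial n∈S n∈N) ⟩
      ρ x (a ε) + a x            ≡⟨ a-triv x ε x∈S ε∈S ⟨
      f (π x) (π ε) + a (x · ε)  ≡⟨ cong (λ z → f (π x) (π ε) + a z) (idʳ H x) ⟩
      f (π x) (π ε) + a x        ∎)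

  descend : (S : Subset H) (φ : Carrier H → V)
    → (∀ {x y} → Mem H x S → Mem H y S → π x ≡ π y → φ x ≡ φ y)
    → Σ (Carrier G → V) λ ψ → ∀ x → Mem H x S → ψ (π x) ≡ φ x
  descend S φ φ-constant = ψ , ψ∘π
    where
    pick : ∀ g → Dec (∃ λ x → Mem H x S × π x ≡ g) → V
    pick g (yes (x , _)) = φ x
    pick g (no _) = 0#

    ψ : Carrier G → V
    ψ g = pick g (preimage? S g)

    ψ∘π : ∀ x → Mem H x S → ψ (π x) ≡ φ x
    ψ∘π x x∈S with preimage? S (π x)
    ... | yes (x′ , x′∈S , πx′≡πx) = φ-constant x′∈S x∈S πx′≡πx
    ... | no ∄x = ⊥-elim (∄x (x , x∈S , refl))

  trivialiser-descends : (f : Cochain2 G R) (S : Subset H) → IsSubgroup H S → (T : Subset G)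
    → (∀ {g} → Mem G g T → ∃ λ x → Mem H x S × π x ≡ g)
    → (a : Carrier H → V) → CH.Trivialises S (inflate H G π f) a
    → (ψ : Carrier G → V) → (∀ x → Mem H x S → ψ (π x) ≡ a x)
    → CG.Trivialises T f ψ
  trivialiser-descends f S (_ , ∙-closed , _) T T⊆πS a a-triv ψ ψ∘π g h g∈T h∈T
    with T⊆πS g∈T | T⊆πS h∈T
  ... | x , x∈S , refl | y , y∈S , refl = begin
    f (π x) (π y) + ψ (_∙_ G (π x) (π y))   ≡⟨ cong (λ g → f (π x) (π y) + ψ g) (π-hom x y) ⟨
    f (π x) (π y) + ψ (π (x · y))           ≡⟨ cong (f (π x) (π y) +_) (ψ∘π (x · y) (∙-closed x y x∈S y∈S)) ⟩
    f (π x) (π y) + a (x · y)               ≡⟨ a-triv x y x∈S y∈S ⟩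
    ρ x (a y) + a x                         ≡⟨ cong₂ (λ u v → ρ x u + v) (ψ∘π y y∈S) (ψ∘π x x∈S) ⟨
    act M (π x) (ψ (π y)) + ψ (π x)         ∎

  coboundary-descends : (f : Cochain2 G R) (S : Subset H) → IsSubgroup H S → (T : Subset G)
    → (∀ {g} → Mem G g T → ∃ λ x → Mem H x S × π x ≡ g)
    → IsCoboundaryOn H ρ S (inflate H G π f) → IsCoboundaryOn G (act M) T f
  coboundary-descends f S S-subgroup T T⊆πS (a , a-triv) =
    proj₁ descent , trivialiser-descends f S S-subgroup T T⊆πS a a-triv (proj₁ descent) (proj₂ descent)
    where
    descent : Σ (Carrier G → V) λ ψ → ∀ x → Mem H x S → ψ (π x) ≡ a x
    descent = descend S a (fibre-constant f S S-subgroup a a-triv)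

  inflate-cocycle : ∀ {f} → IsCocycle G (act M) f → IsCocycle H ρ (inflate H G π f)
  inflate-cocycle f-cocycle x y z rewrite π-hom y z | π-hom x y = f-cocycle (π x) (π y) (π z)

  inflate-coboundaryOn : ∀ {f} S → IsCoboundaryOn G (act M) (image H G π S) f
    → IsCoboundaryOn H ρ S (inflate H G π f)
  inflate-coboundaryOn {f} S (c , c-triv) = c ∘ π , λ x y x∈S y∈S →
    trans (cong (λ g → f (π x) (π y) + c g) (π-hom x y))
      (c-triv (π x) (π y) (image-∋ S x∈S) (image-∋ S y∈S))

  inflation-preserves-III : (𝒟 : Subset G → Set) (𝒟̃ : Subset H → Set)
    → (∀ D̃ → 𝒟̃ D̃ → 𝒟 (image H G π D̃))
    → (f : Cochain2 G R) → InIII G (act M) 𝒟 f → InIII H ρ 𝒟̃ (inflate H G π f)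
  inflation-preserves-III 𝒟 𝒟̃ image∈𝒟 f (f-cocycle , f-III) =
    inflate-cocycle f-cocycle , λ D̃ D̃∈𝒟̃ → inflate-coboundaryOn D̃ (f-III _ (image∈𝒟 D̃ D̃∈𝒟̃))

  inflation-reflects-cohomologous : Surjective H G π → (f f′ : Cochain2 G R)
    → Cohomologous H ρ (inflate H G π f) (inflate H G π f′) → Cohomologous G (act M) f f′
  inflation-reflects-cohomologous surj f f′ = coboundary-descends (λ g h → f g h -ᵥ f′ g h)
    (full H) (full-subgroup H) (full G) λ {g} _ → proj₁ (surj g) , ∈-full H _ , proj₂ (surj g)

  -- Averaging over H shows that |H| f is a coboundary on ker π; as ℤ^r is
  -- torsion-free, so is f.
  module Averaging (f : Cochain2 H R) (f-cocycle : IsCocycle H ρ f)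
                   (f-cyclic : ∀ x → IsCoboundaryOn H ρ (cyclic H x) f) where

    |H| : V
    |H| = scalar (ℤ.+ order H)

    |H|≢0 : ℤ.+ order H ≢ 0ℤ
    |H|≢0 eq = ℕ.n≮0 (subst (toℕ ε ℕ.<_) (ℤ.+-injective eq) (Fin.toℕ<n ε))

    average : Carrier H → V
    average x = sum (f x)

    averaging : ∀ {n} m → Kernel n → |H| * f n m + average (n · m) ≡ average m + average n
    averaging {n} m n∈N = begin
      |H| * f n m + average (n · m)                      ≡⟨ cong (_+ average (n · m)) constant ⟨
      sum (λ (_ : Carrier H) → f n m) + average (n · m)  ≡⟨ +-comm _ _ ⟩
      average (n · m) + sum (λ (_ : Carrier H) → f n m)  ≡⟨ summed ⟨
      average m + sum (λ y → f n (m · y))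
        ≡⟨ cong (average m +_) (∑-permute (f n) (left-translation m)) ⟨
      average m + average n                              ∎
      where
      pointwise : ∀ y → f m y + f n (m · y) ≡ f (n · m) y + f n m
      pointwise y = trans (cong (_+ f n (m · y)) (sym (ρ-kernel n∈N (f m y)))) (f-cocycle n m y)
      summed : average m + sum (λ y → f n (m · y)) ≡ average (n · m) + sum (λ (_ : Carrier H) → f n m)
      summed = trans (sym (∑-distrib-+ (f m) (λ y → f n (m · y))))
        (trans (sum-cong-≗ pointwise) (∑-distrib-+ (f (n · m)) (λ _ → f n m)))
      constant : sum (λ (_ : Carrier H) → f n m) ≡ |H| * f n m
      constant = trans (sum-replicate (order H) {f n m}) (×ᵥ≡scalar* (order H) (f n m))
      left-translation : Carrier H → Permutation (order H) (order H)
      left-translation m = permutation (m ·_) (inv H m ·_) (\\-leftDividesˡ m) (\\-leftDividesʳ m)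

    b : Carrier H → V
    b x = proj₁ (f-cyclic x) x

    average≡|H|*b : ∀ {n} → Kernel n → average n ≡ |H| * b n
    average≡|H|*b {n} n∈N = x-y≡0⇒x≡y (pow-additive⇒≡0 H Ψ n Ψ-ε Ψ-additive)
      where
      a : Carrier H → V
      a = proj₁ (f-cyclic n)

      a-triv : CH.Trivialises (cyclic H n) f a
      a-triv = proj₂ (f-cyclic n)

      Ψ : Carrier H → V
      Ψ x = average x - |H| * a x

      Ψ-ε : Ψ ε ≡ 0#
      Ψ-ε = by-difference
        (⊖ x≡y⇒x-y≡0 averaging-ε ⊕ |H| ⊛ x≡y⇒x-y≡0 trivialises-ε)
        (solve 4 (λ o F Aε aε →
           Aε :- o :* aε :- con 0ℤ := :- ((o :* F :+ Aε) :- (Aε :+ Aε)) :+ o :* ((F :+ aε) :- (aε :+ aε))) refl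
          |H| (f ε ε) (average ε) (a ε))
        where
        ε∈⟨n⟩ : Mem H ε (cyclic H n)
        ε∈⟨n⟩ = pow∈cyclic n 0 ℕ.z≤n

        averaging-ε : |H| * f ε ε + average ε ≡ average ε + average ε
        averaging-ε = trans (cong (λ x → |H| * f ε ε + average x) (sym (idˡ H ε))) (averaging ε π-e)
        trivialises-ε : f ε ε + a ε ≡ a ε + a ε
        trivialises-ε = begin
          f ε ε + a ε         ≡⟨ cong (λ x → f ε ε + a x) (idˡ H ε) ⟨
          f ε ε + a (ε · ε)   ≡⟨ a-triv ε ε ε∈⟨n⟩ ε∈⟨n⟩ ⟩
          ρ ε (a ε) + a ε     ≡⟨ cong (_+ a ε) (ρ-kernel π-e (a ε)) ⟩
          a ε + a ε           ∎

      Ψ-additive : ∀ k → k ℕ.< order H → Ψ (n · pow H n k) ≡ Ψ n + Ψ (pow H n k)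
      Ψ-additive k k<|H| = by-difference
        (x≡y⇒x-y≡0 (averaging p n∈N) ⊕ ⊖ (|H| ⊛ x≡y⇒x-y≡0 trivialises-np))
        (solve 8 (λ o F Anp An Ap anp an ap →
           (Anp :- o :* anp) :- ((An :- o :* an) :+ (Ap :- o :* ap))
             := ((o :* F :+ Anp) :- (Ap :+ An)) :- o :* ((F :+ anp) :- (ap :+ an))) refl
           |H| (f n p) (average (n · p)) (average n) (average p) (a (n · p)) (a n) (a p))
        where
        p = pow H n k
        trivialises-np : f n p + a (n · p) ≡ a p + a n
        trivialises-np = trans (a-triv n p (∈cyclic n) (pow∈cyclic n k (ℕ.<⇒≤ k<|H|)))
          (cong (_+ a n) (ρ-kernel n∈N (a p)))

    kernel-trivialisation : ∀ {n m} → Kernel n → Kernel m → (f CH.-δ b) n m ≡ 0#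
    kernel-trivialisation {n} {m} n∈N m∈N = begin
      f n m - (ρ n (b m) - b (n · m) + b n)
        ≡⟨ cong (λ u → f n m - (u - b (n · m) + b n)) (ρ-kernel n∈N (b m)) ⟩
      f n m - (b m - b (n · m) + b n)
        ≡⟨ solve 4 (λ F bm bnm bn → F :- (bm :- bnm :+ bn) := (F :+ bnm) :- (bm :+ bn)) refl
             (f n m) (b m) (b (n · m)) (b n) ⟩
      (f n m + b (n · m)) - (b m + b n)
        ≡⟨ scalar-torsion-free |H|≢0 _ |H|*difference≡0 ⟩
      0# ∎
      where
      |H|*difference≡0 : |H| * ((f n m + b (n · m)) - (b m + b n)) ≡ 0#
      |H|*difference≡0 = by-difference
        (x≡y⇒x-y≡0 (averaging m n∈N)
          ⊕ ⊖ x≡y⇒x-y≡0 (average≡|H|*b (kernel-∙ n∈N m∈N))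
          ⊕ x≡y⇒x-y≡0 (average≡|H|*b m∈N)
          ⊕ x≡y⇒x-y≡0 (average≡|H|*b n∈N))
        (solve 8 (λ o F bnm bm bn Anm Am An →
           o :* ((F :+ bnm) :- (bm :+ bn)) :- con 0ℤ
             := ((o :* F :+ Anm) :- (Am :+ An)) :- (Anm :- o :* bnm) :+ (Am :- o :* bm) :+ (An :- o :* bn)) refl
           |H| (f n m) (b (n · m)) (b m) (b n) (average (n · m)) (average m) (average n))

  vanishing-on-kernel⇒inflated : ∀ {F} → IsCocycle H ρ F
    → (∀ x {n} → Kernel n → F x n ≡ 0#) → (∀ {n} y → Kernel n → F n y ≡ 0#) → Inflated F
  vanishing-on-kernel⇒inflated {F} F-cocycle F-kernelʳ F-kernelˡ {x} {y} {x′} {y′} πx≡πx′ πy≡πy′ = begin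
    F x y                              ≡⟨ F-∙-kernelʳ (fibre⇒kernel (sym (π-∙-kernelˡ y n₁∈N))) ⟨
    F x (y · (inv H y · (n₁ · y)))     ≡⟨ cong (F x) (\\-leftDividesˡ y (n₁ · y)) ⟩
    F x (n₁ · y)                       ≡⟨ F-kernel-shift n₁∈N ⟩
    F (x · n₁) y                       ≡⟨ F-∙-kernelʳ (fibre⇒kernel πy≡πy′) ⟨
    F (x · n₁) (y · (inv H y · y′))    ≡⟨ cong₂ F (\\-leftDividesˡ x x′) (\\-leftDividesˡ y y′) ⟩
    F x′ y′                            ∎
    where
    n₁ = inv H x · x′
    n₁∈N : Kernel n₁
    n₁∈N = fibre⇒kernel πx≡πx′

    ρF≡0 : ∀ {g h k} → F h k ≡ 0# → ρ g (F h k) ≡ 0#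
    ρF≡0 {g} F≡0 = trans (cong (ρ g) F≡0) (act-0# g)

    F-∙-kernelʳ : ∀ {x y n} → Kernel n → F x (y · n) ≡ F x y
    F-∙-kernelʳ {x} {y} {n} n∈N = begin
      F x (y · n)                ≡⟨ +-identityˡ _ ⟨
      0# + F x (y · n)           ≡⟨ cong (_+ F x (y · n)) (ρF≡0 (F-kernelʳ y n∈N)) ⟨
      ρ x (F y n) + F x (y · n)  ≡⟨ F-cocycle x y n ⟩
      F (x · y) n + F x y        ≡⟨ cong (_+ F x y) (F-kernelʳ (x · y) n∈N) ⟩
      0# + F x y                 ≡⟨ +-identityˡ _ ⟩
      F x y                      ∎

    F-kernel-shift : ∀ {x y n} → Kernel n → F x (n · y) ≡ F (x · n) y
    F-kernel-shift {x} {y} {n} n∈N = begin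
      F x (n · y)                ≡⟨ +-identityˡ _ ⟨
      0# + F x (n · y)           ≡⟨ cong (_+ F x (n · y)) (ρF≡0 (F-kernelˡ y n∈N)) ⟨
      ρ x (F n y) + F x (n · y)  ≡⟨ F-cocycle x n y ⟩
      F (x · n) y + F x n        ≡⟨ cong (F (x · n) y +_) (F-kernelʳ x n∈N) ⟩
      F (x · n) y + 0#           ≡⟨ +-identityʳ _ ⟩
      F (x · n) y                ∎

  -- For f vanishing on ker π × ker π, c x = - f (s, s⁻¹ x) with s the chosen
  -- representative of x ker π; f - δc then vanishes once one argument is in ker π.
  module CosetNormalisation (surj : Surjective H G π) (f : Cochain2 H R) (f-cocycle : IsCocycle H ρ f)
                            (f-kernel : ∀ {n m} → Kernel n → Kernel m → f n m ≡ 0#) where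

    representative : Carrier H → Carrier H
    representative x = proj₁ (surj (π x))

    representative-kernel : ∀ x → Kernel (inv H (representative x) · x)
    representative-kernel x = fibre⇒kernel (proj₂ (surj (π x)))

    c : Carrier H → V
    c x = - f (representative x) (inv H (representative x) · x)

    conj : Carrier H → Carrier H → Carrier H
    conj s n = inv H s · (n · s)

    kernel-conj : ∀ s {n} → Kernel n → Kernel (conj s n)
    kernel-conj s n∈N = fibre⇒kernel (sym (π-∙-kernelˡ s n∈N))

    conj-∙-\\ : ∀ s n y → conj s n · (inv H s · y) ≡ inv H s · (n · y)
    conj-∙-\\ s n y = begin
      (inv H s · (n · s)) · (inv H s · y)  ≡⟨ assoc H _ _ _ ⟩
      inv H s · ((n · s) · (inv H s · y))  ≡⟨ cong (inv H s ·_) (assoc H _ _ _) ⟩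
      inv H s · (n · (s · (inv H s · y)))  ≡⟨ cong (λ z → inv H s · (n · z)) (\\-leftDividesˡ s y) ⟩
      inv H s · (n · y)                    ∎

    conj-∙ : ∀ s n m → conj s n · conj s m ≡ conj s (n · m)
    conj-∙ s n m = trans (conj-∙-\\ s n (m · s)) (cong (inv H s ·_) (sym (assoc H n m s)))

    f-ε : ∀ {x} → f x ε ≡ 0# × f ε x ≡ 0#
    f-ε {x} = trans (CH.cocycle-eʳ f-cocycle x) (trans (cong (ρ x) f-εε) (act-0# x))
            , trans (CH.cocycle-eˡ f-cocycle x) f-εε
      where
      f-εε : f ε ε ≡ 0#
      f-εε = f-kernel π-e π-e

    cocycle-kernelˡ : ∀ {n} h k → Kernel n → f h k + f n (h · k) ≡ f (n · h) k + f n h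
    cocycle-kernelˡ {n} h k n∈N = trans (cong (_+ f n (h · k)) (sym (ρ-kernel n∈N (f h k)))) (f-cocycle n h k)

    cocycle-kernel² : ∀ g {n m} → Kernel n → Kernel m → f g (n · m) ≡ f (g · n) m + f g n
    cocycle-kernel² g {n} {m} n∈N m∈N = begin
      f g (n · m)                ≡⟨ +-identityˡ _ ⟨
      0# + f g (n · m)           ≡⟨ cong (_+ f g (n · m)) (trans (cong (ρ g) (f-kernel n∈N m∈N)) (act-0# g)) ⟨
      ρ g (f n m) + f g (n · m)  ≡⟨ f-cocycle g n m ⟩
      f (g · n) m + f g n        ∎

    c-kernel : ∀ {n} → Kernel n → c n ≡ 0#
    c-kernel {n} n∈N = trans (cong -_ (f-kernel (trans (proj₂ (surj (π n))) n∈N) (representative-kernel n)))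
      (solve 0 (:- con 0ℤ := con 0ℤ) refl)

    c-∙-kernelʳ : ∀ x {n} → Kernel n → c (x · n) ≡ c x - f x n
    c-∙-kernelʳ x {n} n∈N = begin
      - f (representative (x · n)) (inv H (representative (x · n)) · (x · n))
        ≡⟨ cong (λ g → - f (proj₁ (surj g)) (inv H (proj₁ (surj g)) · (x · n))) (π-∙-kernelʳ x n∈N) ⟩
      - f s (inv H s · (x · n))      ≡⟨ cong (λ z → - f s z) (sym (assoc H _ _ _)) ⟩
      - f s (m · n)                  ≡⟨ cong -_ (cocycle-kernel² s (representative-kernel x) n∈N) ⟩
      - (f (s · m) n + f s m)        ≡⟨ cong (λ z → - (f z n + f s m)) (\\-leftDividesˡ s x) ⟩
      - (f x n + f s m)              ≡⟨ solve 2 (λ F A → :- (F :+ A) := :- A :- F) refl (f x n) (f s m) ⟩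
      c x - f x n                    ∎
      where
      s = representative x
      m = inv H s · x

    conj-invariant : ∀ s {n} → Kernel n → f n s ≡ f s (conj s n)
    conj-invariant s {n} n∈N = x-y≡0⇒x≡y (pow-additive⇒≡0 H Ψ n Ψ-ε λ k _ → additive (kernel-pow n∈N k))
      where
      Ψ : Carrier H → V
      Ψ z = f z s - f s (conj s z)

      Ψ-ε : Ψ ε ≡ 0#
      Ψ-ε = begin
        f ε s - f s (conj s ε)   ≡⟨ cong (λ z → f ε s - f s (inv H s · z)) (idˡ H s) ⟩
        f ε s - f s (inv H s · s) ≡⟨ cong (λ z → f ε s - f s z) (invˡ H s) ⟩
        f ε s - f s ε            ≡⟨ cong₂ _-_ (proj₂ f-ε) (proj₁ f-ε) ⟩
        0# - 0#                  ≡⟨ -‿inverseʳ 0# ⟩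
        0#                       ∎

      additive : ∀ {p} → Kernel p → Ψ (n · p) ≡ Ψ n + Ψ p
      additive {p} p∈N = by-difference
        (⊖ x≡y⇒x-y≡0 (cocycle-kernelˡ p s n∈N) ⊕ ⊖ x≡y⇒x-y≡0 split-conj
          ⊕ x≡y⇒x-y≡0 split-s ⊕ ⊖ f-kernel n∈N p∈N)
        (solve 9 (λ A B C D E P Q S′ T′ →
           (C :- E) :- ((T′ :- Q) :+ (A :- S′))
             := :- ((A :+ B) :- (C :+ D)) :- (E :- (P :+ Q)) :+ ((S′ :+ B) :- (P :+ T′)) :- D) refl
           (f p s) (f n (p · s)) (f (n · p) s) (f n p) (f s (conj s (n · p)))
           (f (n · s) (conj s p)) (f s (conj s n)) (f s (conj s p)) (f n s))
        where
        split-conj : f s (conj s (n · p)) ≡ f (n · s) (conj s p) + f s (conj s n)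
        split-conj = begin
          f s (conj s (n · p))                    ≡⟨ cong (f s) (conj-∙ s n p) ⟨
          f s (conj s n · conj s p)               ≡⟨ cocycle-kernel² s (kernel-conj s n∈N) (kernel-conj s p∈N) ⟩
          f (s · conj s n) (conj s p) + f s (conj s n)
            ≡⟨ cong (λ z → f z (conj s p) + f s (conj s n)) (\\-leftDividesˡ s (n · s)) ⟩
          f (n · s) (conj s p) + f s (conj s n)   ∎
        split-s : f s (conj s p) + f n (p · s) ≡ f (n · s) (conj s p) + f n s
        split-s = trans (cong (λ z → f s (conj s p) + f n z) (sym (\\-leftDividesˡ s (p · s))))
          (cocycle-kernelˡ s (conj s p) n∈N)

    c-∙-kernelˡ : ∀ {n} y → Kernel n → c (n · y) ≡ c y - f n y
    c-∙-kernelˡ {n} y n∈N = begin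
      - f (representative (n · y)) (inv H (representative (n · y)) · (n · y))
        ≡⟨ cong (λ g → - f (proj₁ (surj g)) (inv H (proj₁ (surj g)) · (n · y))) (π-∙-kernelˡ y n∈N) ⟩
      - f s (inv H s · (n · y))        ≡⟨ cong (λ z → - f s z) (conj-∙-\\ s n y) ⟨
      - f s (conj s n · m)             ≡⟨ cong -_ (cocycle-kernel² s (kernel-conj s n∈N) (representative-kernel y)) ⟩
      - (f (s · conj s n) m + f s (conj s n))
        ≡⟨ cong₂ (λ z w → - (f z m + w)) (sym (\\-leftDividesˡ s (n · s))) (conj-invariant s n∈N) ⟨
      - (f (n · s) m + f n s)          ≡⟨ cong -_ (cocycle-kernelˡ s m n∈N) ⟨
      - (f s m + f n (s · m))          ≡⟨ cong (λ z → - (f s m + f n z)) (\\-leftDividesˡ s y) ⟩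
      - (f s m + f n y)                ≡⟨ solve 2 (λ A F → :- (A :+ F) := :- A :- F) refl (f s m) (f n y) ⟩
      c y - f n y                      ∎
      where
      s = representative y
      m = inv H s · y

    normalised-kernelʳ : ∀ x {n} → Kernel n → (f CH.-δ c) x n ≡ 0#
    normalised-kernelʳ x {n} n∈N = begin
      f x n - (ρ x (c n) - c (x · n) + c x)
        ≡⟨ cong₂ (λ u v → f x n - (ρ x u - v + c x)) (c-kernel n∈N) (c-∙-kernelʳ x n∈N) ⟩
      f x n - (ρ x 0# - (c x - f x n) + c x)
        ≡⟨ cong (λ u → f x n - (u - (c x - f x n) + c x)) (act-0# x) ⟩
      f x n - (0# - (c x - f x n) + c x)
        ≡⟨ solve 2 (λ F C → F :- (con 0ℤ :- (C :- F) :+ C) := con 0ℤ) refl (f x n) (c x) ⟩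
      0# ∎

    normalised-kernelˡ : ∀ {n} y → Kernel n → (f CH.-δ c) n y ≡ 0#
    normalised-kernelˡ {n} y n∈N = begin
      f n y - (ρ n (c y) - c (n · y) + c n)
        ≡⟨ cong₂ (λ u v → f n y - (u - v + c n)) (ρ-kernel n∈N (c y)) (c-∙-kernelˡ y n∈N) ⟩
      f n y - (c y - (c y - f n y) + c n)
        ≡⟨ cong (λ w → f n y - (c y - (c y - f n y) + w)) (c-kernel n∈N) ⟩
      f n y - (c y - (c y - f n y) + 0#)
        ≡⟨ solve 2 (λ F C → F :- (C :- (C :- F) :+ con 0ℤ) := con 0ℤ) refl (f n y) (c y) ⟩
      0# ∎

    normalised-inflated : Inflated (f CH.-δ c)
    normalised-inflated =
      vanishing-on-kernel⇒inflated (CH.-δ-cocycle f-cocycle c) normalised-kernelʳ normalised-kernelˡ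

  inflated-representative : Surjective H G π → (f : Cochain2 H R) → IsCocycle H ρ f
    → (∀ x → IsCoboundaryOn H ρ (cyclic H x) f) → ∃ λ w → Inflated (f CH.-δ w)
  inflated-representative surj f f-cocycle f-cyclic = (λ x → b x + c x) , λ πx≡πx′ πy≡πy′ →
    trans (sym (CH.-δ-twice f b c _ _))
      (trans (normalised-inflated πx≡πx′ πy≡πy′) (CH.-δ-twice f b c _ _))
    where
    open Averaging f f-cocycle f-cyclic using (b; kernel-trivialisation)
    open CosetNormalisation surj (f CH.-δ b) (CH.-δ-cocycle f-cocycle b) kernel-trivialisation
      using (c; normalised-inflated)

  module Descent (surj : Surjective H G π) {F : Cochain2 H R} (F-inflated : Inflated F) where

    section : Carrier G → Carrier H
    section g = proj₁ (surj g)

    π∘section : ∀ g → π (section g) ≡ g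
    π∘section g = proj₂ (surj g)

    π-section-∙ : ∀ g h → π (section (_∙_ G g h)) ≡ π (section g · section h)
    π-section-∙ g h = trans (π∘section _)
      (sym (trans (π-hom _ _) (cong₂ (_∙_ G) (π∘section g) (π∘section h))))

    descended : Cochain2 G R
    descended g h = F (section g) (section h)

    inflate-descended : ∀ x y → inflate H G π descended x y ≡ F x y
    inflate-descended x y = F-inflated (π∘section (π x)) (π∘section (π y))

    descended-cocycle : IsCocycle H ρ F → IsCocycle G (act M) descended
    descended-cocycle F-cocycle g h k = begin
      act M g (descended h k) + F x (section (_∙_ G h k))
        ≡⟨ cong₂ (λ g′ u → act M g′ (descended h k) + u)
             (π∘section g) (F-inflated refl (sym (π-section-∙ h k))) ⟨
      ρ x (F y z) + F x (y · z)
        ≡⟨ F-cocycle x y z ⟩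
      F (x · y) z + F x y
        ≡⟨ cong (_+ F x y) (F-inflated (π-section-∙ g h) refl) ⟨
      descended (_∙_ G g h) k + descended g h ∎
      where
      x = section g
      y = section h
      z = section k

  inflation-surjective : Surjective H G π → (𝒟 : Subset G → Set) (𝒟̃ : Subset H → Set)
    → (∀ D̃ → 𝒟̃ D̃ → IsSubgroup H D̃) → (∀ x → 𝒟̃ (cyclic H x))
    → (∀ D → 𝒟 D → ∃ λ D̃ → 𝒟̃ D̃ × image H G π D̃ ≡ D)
    → (f̃ : Cochain2 H R) → InIII H ρ 𝒟̃ f̃
    → ∃ λ f → InIII G (act M) 𝒟 f × Cohomologous H ρ (inflate H G π f) f̃
  inflation-surjective surj 𝒟 𝒟̃ 𝒟̃-subgroups cyclic∈𝒟̃ lift f̃ (f̃-cocycle , f̃-III) =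
    descended , (descended-cocycle (CH.-δ-cocycle f̃-cocycle w) , descended-III) , inflate-descended∼f̃
    where
    normal-form : ∃ λ w → Inflated (f̃ CH.-δ w)
    normal-form = inflated-representative surj f̃ f̃-cocycle λ x → f̃-III (cyclic H x) (cyclic∈𝒟̃ x)

    w : Carrier H → V
    w = proj₁ normal-form

    open Descent surj (proj₂ normal-form)

    descended-III : ∀ D → 𝒟 D → IsCoboundaryOn G (act M) D descended
    descended-III D D∈𝒟 with lift D D∈𝒟
    ... | D̃ , D̃∈𝒟̃ , refl =
      coboundary-descends descended D̃ (𝒟̃-subgroups D̃ D̃∈𝒟̃) (image H G π D̃) (image⇒preimage D̃)
        (_ , CH.trivialises-resp D̃ (λ x y → sym (inflate-descended x y))
               (CH.-δ-trivialises D̃ w (proj₂ (f̃-III D̃ D̃∈𝒟̃))))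

    inflate-descended∼f̃ : Cohomologous H ρ (inflate H G π descended) f̃
    inflate-descended∼f̃ = proj₁ F∼f̃ ,
      CH.trivialises-resp (full H) (λ x y → cong (_-ᵥ f̃ x y) (sym (inflate-descended x y))) (proj₂ F∼f̃)
      where
      F∼f̃ : Cohomologous H ρ (f̃ CH.-δ w) f̃
      F∼f̃ = CH.-δ-cohomologous f̃ w

proposition2p9 : (G̃ G : FinGroup) (π : Carrier G̃ → Carrier G)
    → IsHom G̃ G π → Surjective G̃ G π
    → (M : Lattice G)
    → (𝒟 : Subset G → Set) (𝒟̃ : Subset G̃ → Set)
    → (∀ D → 𝒟 D → IsSubgroup G D)
    → (∀ D̃ → 𝒟̃ D̃ → IsSubgroup G̃ D̃)
    → (∀ g → 𝒟̃ (cyclic G̃ g))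
    → (∀ D̃ → 𝒟̃ D̃ → 𝒟 (image G̃ G π D̃))
    → (∀ D → 𝒟 D → ∃ λ D̃ → 𝒟̃ D̃ × image G̃ G π D̃ ≡ D)
    → ((f : Cochain2 G (rank M)) → InIII G (act M) 𝒟 f
         → InIII G̃ (λ x → act M (π x)) 𝒟̃ (inflate G̃ G π f))
      × ((f f' : Cochain2 G (rank M)) → InIII G (act M) 𝒟 f → InIII G (act M) 𝒟 f'
         → Cohomologous G̃ (λ x → act M (π x)) (inflate G̃ G π f) (inflate G̃ G π f')
         → Cohomologous G (act M) f f')
      × ((f̃ : Cochain2 G̃ (rank M)) → InIII G̃ (λ x → act M (π x)) 𝒟̃ f̃
         → ∃ λ f → InIII G (act M) 𝒟 f
                 × Cohomologous G̃ (λ x → act M (π x)) (inflate G̃ G π f) f̃)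
proposition2p9 G̃ G π π-hom surj M 𝒟 𝒟̃ _ 𝒟̃-subgroups cyclic∈𝒟̃ image∈𝒟 lift =
    inflation-preserves-III 𝒟 𝒟̃ image∈𝒟
  , (λ f f′ _ _ → inflation-reflects-cohomologous surj f f′)
  , inflation-surjective surj 𝒟 𝒟̃ 𝒟̃-subgroups cyclic∈𝒟̃ lift
  where open Inflation G̃ G π π-hom M
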